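{- Let $F$ be a full context of the CBV calculus. If $F\langle t\rangle$ is CBV-meaningful for some CBV-meaningless term $t$, then $F\langle u\rangle$ is CBV-meaningful for every term $u$.
   Context: Terms: $t,u ::= v \mid t\,u \mid t[x\backslash u]$, values $v ::= x \mid \lambda x.t$ ($\lambda x.t$, $t[x\backslash u]$ bind $x$ in $t$; terms up to $\alpha$; $t\{x:=u\}$ capture-avoiding substitution). List contexts $L ::= \langle\cdot\rangle \mid L[x\backslash t]$. CBV surface contexts $V ::= \langle\cdot\rangle \mid V\,t \mid t\,V \mid V[x\backslash t] \mid t[x\backslash V]$. Full contexts $F ::= \langle\cdot\rangle \mid F\,t \mid t\,F \mid \lambda x.F \mid F[x\backslash t] \mid t[x\backslash F]$. CBV rules (capture-free): $L\langle\lambda x.t\rangle u\mapsto L\langle t[x\backslash u]\rangle$ and $t[x\backslash L\langle v\rangle]\mapsto L\langle t\{x:=v\}\rangle$ for $v$ a value; CBV surface reduction $\to_v$ is their closure under CBV surface contexts. Testing contexts $T ::= \langle\cdot\rangle \mid T\,u \mid (\lambda x.T)\,u$. A term $t$ is CBV-meaningful if $T\langle t\rangle\to_v^* v$ for some testing context $T$ and some value $v$, and CBV-meaningless otherwise. -}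

module Defs where

open import Data.Nat using (ℕ; zero; suc; _+_)
open import Data.List using (List; []; _∷_; length)
open import Data.Product using (Σ; ∃; _×_; _,_)
open import Relation.Binary.Construct.Closure.ReflexiveTransitive using (Star)

-- Terms of the value substitution calculus, with de Bruijn indices
-- (terms are thus identified up to α-equivalence).
--   var n      : variable
--   lam t      : λx.t            (binds index 0 in t)
--   app t u    : t u
--   es t u     : t[x\u]          (binds index 0 in t, not in u)
data Term : Set where
  var : ℕ → Term
  lam : Term → Term
  app : Term → Term → Term
  es  : Term → Term → Term

data Value : Term → Set where
  vvar : ∀ n → Value (var n)
  vlam : ∀ t → Value (lam t)

ext : (ℕ → ℕ) → ℕ → ℕ
ext ρ zero    = zero
ext ρ (suc n) = suc (ρ n)

rename : (ℕ → ℕ) → Term → Term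
rename ρ (var n)   = var (ρ n)
rename ρ (lam t)   = lam (rename (ext ρ) t)
rename ρ (app t u) = app (rename ρ t) (rename ρ u)
rename ρ (es t u)  = es (rename (ext ρ) t) (rename ρ u)

exts : (ℕ → Term) → ℕ → Term
exts σ zero    = var zero
exts σ (suc n) = rename suc (σ n)

subst : (ℕ → Term) → Term → Term
subst σ (var n)   = σ n
subst σ (lam t)   = lam (subst (exts σ) t)
subst σ (app t u) = app (subst σ t) (subst σ u)
subst σ (es t u)  = es (subst (exts σ) t) (subst σ u)

-- List contexts L ::= ⟨·⟩ | L[x\t]; the list head is the outermost
-- explicit substitution.  Plugging captures (the hole is under |L| binders).
LCtx : Set
LCtx = List Term

plugL : LCtx → Term → Term
plugL []      t = t
plugL (s ∷ L) t = es (plugL L t) s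

data VCtx : Set where
  hole  : VCtx
  appL  : VCtx → Term → VCtx
  appR  : Term → VCtx → VCtx
  esL   : VCtx → Term → VCtx
  esR   : Term → VCtx → VCtx

plugV : VCtx → Term → Term
plugV hole       t = t
plugV (appL V s) t = app (plugV V t) s
plugV (appR s V) t = app s (plugV V t)
plugV (esL V s)  t = es (plugV V t) s
plugV (esR s V)  t = es s (plugV V t)

data FCtx : Set where
  hole  : FCtx
  appL  : FCtx → Term → FCtx
  appR  : Term → FCtx → FCtx
  lamF  : FCtx → FCtx
  esL   : FCtx → Term → FCtx
  esR   : Term → FCtx → FCtx

plugF : FCtx → Term → Term
plugF hole       t = t
plugF (appL F s) t = app (plugF F t) s
plugF (appR s F) t = app s (plugF F t)
plugF (lamF F)   t = lam (plugF F t)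
plugF (esL F s)  t = es (plugF F t) s
plugF (esR s F)  t = es s (plugF F t)

data TCtx : Set where
  hole  : TCtx
  appT  : TCtx → Term → TCtx
  redex : TCtx → Term → TCtx

plugT : TCtx → Term → Term
plugT hole        t = t
plugT (appT T u)  t = app (plugT T t) u
plugT (redex T u) t = app (lam (plugT T t)) u

-- Substitution t{x:=v} moved under the |L| binders of L:
-- index 0 ↦ v, index (suc i) ↦ var (i + |L|).
sv-sub : Term → ℕ → ℕ → Term
sv-sub v k zero    = v
sv-sub v k (suc i) = var (i + k)

-- Root rules (capture-free, realised by shifting):
--   L⟨λx.t⟩ u ↦ L⟨t[x\u]⟩
--   t[x\L⟨v⟩] ↦ L⟨t{x:=v}⟩
data _↦_ : Term → Term → Set where
  dB : ∀ (L : LCtx) t u →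
       app (plugL L (lam t)) u ↦ plugL L (es t (rename (λ i → i + length L) u))
  sv : ∀ (L : LCtx) t v → Value v →
       es t (plugL L v) ↦ plugL L (subst (sv-sub v (length L)) t)

data _→v_ : Term → Term → Set where
  surf : ∀ (V : VCtx) {t t'} → t ↦ t' → plugV V t →v plugV V t'

_→v*_ : Term → Term → Set
_→v*_ = Star _→v_

Meaningful : Term → Set
Meaningful t = Σ TCtx λ T → Σ Term λ v → Value v × (plugT T t →v* v)

module Submission where

open import Defs
open import Relation.Nullary using (¬_)
open import Data.Empty using (⊥-elim)
open import Data.List using ([]; _∷_; length; _++_; [_])
open import Data.List.Properties using (length-++)
open import Data.List.Relation.Binary.Pointwise using (Pointwise; []; _∷_; Pointwise-length)
open import Data.Nat using (ℕ; zero; suc; _+_; _<_; _≤_; _⊔_; s≤s)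
open import Data.Nat.Properties using (+-suc; +-identityʳ; +-assoc; m≤m⊔n; m≤n⊔m; n≤1+n; ≤-trans; ≤-refl)
open import Data.Product using (Σ; _×_; _,_)
open import Data.Sum using (_⊎_; inj₁; inj₂)
open import Function using (_∘_; id)
open import Relation.Binary.Construct.Closure.ReflexiveTransitive using (Star; ε; _◅_; _◅◅_; gmap)
open import Relation.Binary.PropositionalEquality
  using (_≡_; _≢_; refl; sym; trans; cong; cong₂; subst₂; _≗_; module ≡-Reasoning)
  renaming (subst to transport)

-- Call a meaningful if W⟨a⟩ reduces to a value for some weak context W ::= ⟨·⟩ | W u | W[x\u]
-- (a testing context (λx.T) u reaches T[x\u] in one dB-step, so CBV-meaningless terms are
-- meaningless in this sense); this notion is reflected by substitutions of values.  Write s ∼ s'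
-- when s' arises from s by replacing instances a{ρ}, with a meaningless and ρ a substitution of
-- values, by arbitrary terms.  As long as s has no such instance in surface position, every
-- step of s is matched by the same step of s'.  A term with a meaningless instance in surface
-- position never reaches a value: after one step the instance has either been contracted to a
-- term that is still meaningless, or it persists in surface position under a value substitution;
-- replacing it by Ω, the simulation turns the remaining reduction into a reduction to a value of
-- a term with Ω in surface position, impossible since surface Ω persists.  The theorem is the
-- simulation applied to T⟨F⟨t⟩⟩ ∼ T⟨F⟨u⟩⟩.

ext-cong : ∀ {ρ ρ'} → ρ ≗ ρ' → ext ρ ≗ ext ρ'
ext-cong e zero    = refl
ext-cong e (suc i) = cong suc (e i)

rename-cong : ∀ {ρ ρ'} → ρ ≗ ρ' → rename ρ ≗ rename ρ'
rename-cong e (var n)   = cong var (e n)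
rename-cong e (lam t)   = cong lam (rename-cong (ext-cong e) t)
rename-cong e (app t u) = cong₂ app (rename-cong e t) (rename-cong e u)
rename-cong e (es t u)  = cong₂ es (rename-cong (ext-cong e) t) (rename-cong e u)

exts-cong : ∀ {σ σ'} → σ ≗ σ' → exts σ ≗ exts σ'
exts-cong e zero    = refl
exts-cong e (suc i) = cong (rename suc) (e i)

subst-cong : ∀ {σ σ'} → σ ≗ σ' → subst σ ≗ subst σ'
subst-cong e (var n)   = e n
subst-cong e (lam t)   = cong lam (subst-cong (exts-cong e) t)
subst-cong e (app t u) = cong₂ app (subst-cong e t) (subst-cong e u)
subst-cong e (es t u)  = cong₂ es (subst-cong (exts-cong e) t) (subst-cong e u)

ext-∘ : ∀ ρ ρ' → ext ρ ∘ ext ρ' ≗ ext (ρ ∘ ρ')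
ext-∘ ρ ρ' zero    = refl
ext-∘ ρ ρ' (suc i) = refl

rename-rename : ∀ ρ ρ' → rename ρ ∘ rename ρ' ≗ rename (ρ ∘ ρ')
rename-rename ρ ρ' (var n)   = refl
rename-rename ρ ρ' (lam t)   =
  cong lam (trans (rename-rename (ext ρ) (ext ρ') t) (rename-cong (ext-∘ ρ ρ') t))
rename-rename ρ ρ' (app t u) = cong₂ app (rename-rename ρ ρ' t) (rename-rename ρ ρ' u)
rename-rename ρ ρ' (es t u)  =
  cong₂ es (trans (rename-rename (ext ρ) (ext ρ') t) (rename-cong (ext-∘ ρ ρ') t))
           (rename-rename ρ ρ' u)

ext-id : ext id ≗ id
ext-id zero    = refl
ext-id (suc i) = refl

rename-id : rename id ≗ id
rename-id (var n)   = refl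
rename-id (lam t)   = cong lam (trans (rename-cong ext-id t) (rename-id t))
rename-id (app t u) = cong₂ app (rename-id t) (rename-id u)
rename-id (es t u)  = cong₂ es (trans (rename-cong ext-id t) (rename-id t)) (rename-id u)

rename-+0 : rename (_+ 0) ≗ id
rename-+0 u = trans (rename-cong +-identityʳ u) (rename-id u)

exts-ext : ∀ σ ρ → exts σ ∘ ext ρ ≗ exts (σ ∘ ρ)
exts-ext σ ρ zero    = refl
exts-ext σ ρ (suc i) = refl

subst-rename : ∀ σ ρ → subst σ ∘ rename ρ ≗ subst (σ ∘ ρ)
subst-rename σ ρ (var n)   = refl
subst-rename σ ρ (lam t)   =
  cong lam (trans (subst-rename (exts σ) (ext ρ) t) (subst-cong (exts-ext σ ρ) t))
subst-rename σ ρ (app t u) = cong₂ app (subst-rename σ ρ t) (subst-rename σ ρ u)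
subst-rename σ ρ (es t u)  =
  cong₂ es (trans (subst-rename (exts σ) (ext ρ) t) (subst-cong (exts-ext σ ρ) t))
           (subst-rename σ ρ u)

ext-exts : ∀ ρ σ → rename (ext ρ) ∘ exts σ ≗ exts (rename ρ ∘ σ)
ext-exts ρ σ zero    = refl
ext-exts ρ σ (suc i) = trans (rename-rename (ext ρ) suc (σ i)) (sym (rename-rename suc ρ (σ i)))

rename-subst : ∀ ρ σ → rename ρ ∘ subst σ ≗ subst (rename ρ ∘ σ)
rename-subst ρ σ (var n)   = refl
rename-subst ρ σ (lam t)   =
  cong lam (trans (rename-subst (ext ρ) (exts σ) t) (subst-cong (ext-exts ρ σ) t))
rename-subst ρ σ (app t u) = cong₂ app (rename-subst ρ σ t) (rename-subst ρ σ u)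
rename-subst ρ σ (es t u)  =
  cong₂ es (trans (rename-subst (ext ρ) (exts σ) t) (subst-cong (ext-exts ρ σ) t))
           (rename-subst ρ σ u)

exts-exts : ∀ σ τ → subst (exts σ) ∘ exts τ ≗ exts (subst σ ∘ τ)
exts-exts σ τ zero    = refl
exts-exts σ τ (suc i) = trans (subst-rename (exts σ) suc (τ i)) (sym (rename-subst suc σ (τ i)))

subst-subst : ∀ σ τ → subst σ ∘ subst τ ≗ subst (subst σ ∘ τ)
subst-subst σ τ (var n)   = refl
subst-subst σ τ (lam t)   =
  cong lam (trans (subst-subst (exts σ) (exts τ) t) (subst-cong (exts-exts σ τ) t))
subst-subst σ τ (app t u) = cong₂ app (subst-subst σ τ t) (subst-subst σ τ u)
subst-subst σ τ (es t u)  =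
  cong₂ es (trans (subst-subst (exts σ) (exts τ) t) (subst-cong (exts-exts σ τ) t))
           (subst-subst σ τ u)

exts-var : exts var ≗ var
exts-var zero    = refl
exts-var (suc i) = refl

subst-var : subst var ≗ id
subst-var (var n)   = refl
subst-var (lam t)   = cong lam (trans (subst-cong exts-var t) (subst-var t))
subst-var (app t u) = cong₂ app (subst-var t) (subst-var u)
subst-var (es t u)  = cong₂ es (trans (subst-cong exts-var t) (subst-var t)) (subst-var u)

var-ext : ∀ ρ → var ∘ ext ρ ≗ exts (var ∘ ρ)
var-ext ρ zero    = refl
var-ext ρ (suc i) = refl

rename≗subst-var : ∀ ρ → rename ρ ≗ subst (var ∘ ρ)
rename≗subst-var ρ (var n)   = refl
rename≗subst-var ρ (lam t)   =
  cong lam (trans (rename≗subst-var (ext ρ) t) (subst-cong (var-ext ρ) t))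
rename≗subst-var ρ (app t u) = cong₂ app (rename≗subst-var ρ t) (rename≗subst-var ρ u)
rename≗subst-var ρ (es t u)  =
  cong₂ es (trans (rename≗subst-var (ext ρ) t) (subst-cong (var-ext ρ) t))
           (rename≗subst-var ρ u)

es-injectiveˡ : ∀ {a b c d} → es a b ≡ es c d → a ≡ c
es-injectiveˡ refl = refl

es-injectiveʳ : ∀ {a b c d} → es a b ≡ es c d → b ≡ d
es-injectiveʳ refl = refl

app-injectiveˡ : ∀ {a b c d} → app a b ≡ app c d → a ≡ c
app-injectiveˡ refl = refl

ValueSub : (ℕ → Term) → Set
ValueSub σ = ∀ i → Value (σ i)

Value-rename : ∀ ρ {v} → Value v → Value (rename ρ v)
Value-rename ρ (vvar n) = vvar _
Value-rename ρ (vlam t) = vlam _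

Value-subst : ∀ {σ} → ValueSub σ → ∀ {v} → Value v → Value (subst σ v)
Value-subst vσ (vvar n) = vσ n
Value-subst vσ (vlam t) = vlam _

Value-unsubst : ∀ a σ → Value (subst σ a) → Value a
Value-unsubst (var n) σ _ = vvar n
Value-unsubst (lam a) σ _ = vlam a

exts-ValueSub : ∀ {σ} → ValueSub σ → ValueSub (exts σ)
exts-ValueSub vσ zero    = vvar 0
exts-ValueSub vσ (suc i) = Value-rename suc (vσ i)

sv-sub-ValueSub : ∀ {v} → Value v → ∀ k → ValueSub (sv-sub v k)
sv-sub-ValueSub vv k zero    = vv
sv-sub-ValueSub vv k (suc i) = vvar _

-- Surface reduction, syntax-directed

infix 4 _⟶_ _⟶*_

data _⟶_ : Term → Term → Set where
  root : ∀ {s s'}   → s ↦ s' → s ⟶ s'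
  appl : ∀ {s s' u} → s ⟶ s' → app s u ⟶ app s' u
  appr : ∀ {s u u'} → u ⟶ u' → app s u ⟶ app s u'
  esl  : ∀ {s s' u} → s ⟶ s' → es s u ⟶ es s' u
  esr  : ∀ {s u u'} → u ⟶ u' → es s u ⟶ es s u'

_⟶*_ : Term → Term → Set
_⟶*_ = Star _⟶_

⟶-plugV : ∀ V {s s'} → s ⟶ s' → plugV V s ⟶ plugV V s'
⟶-plugV hole       st = st
⟶-plugV (appL V u) st = appl (⟶-plugV V st)
⟶-plugV (appR u V) st = appr (⟶-plugV V st)
⟶-plugV (esL V u)  st = esl (⟶-plugV V st)
⟶-plugV (esR u V)  st = esr (⟶-plugV V st)

→v⇒⟶ : ∀ {s s'} → s →v s' → s ⟶ s'
→v⇒⟶ (surf V r) = ⟶-plugV V (root r)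

⟶⇒→v : ∀ {s s'} → s ⟶ s' → s →v s'
⟶⇒→v (root r) = surf hole r
⟶⇒→v (appl st) with ⟶⇒→v st
... | surf V r = surf (appL V _) r
⟶⇒→v (appr st) with ⟶⇒→v st
... | surf V r = surf (appR _ V) r
⟶⇒→v (esl st) with ⟶⇒→v st
... | surf V r = surf (esL V _) r
⟶⇒→v (esr st) with ⟶⇒→v st
... | surf V r = surf (esR _ V) r

⟶*⇒→v* : ∀ {s s'} → s ⟶* s' → s →v* s'
⟶*⇒→v* = gmap id ⟶⇒→v

→v*⇒⟶* : ∀ {s s'} → s →v* s' → s ⟶* s'
→v*⇒⟶* = gmap id →v⇒⟶

⟶-plugL : ∀ L {s s'} → s ⟶ s' → plugL L s ⟶ plugL L s'
⟶-plugL []      st = st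
⟶-plugL (u ∷ L) st = esl (⟶-plugL L st)

dB₀ : ∀ s u → app (lam s) u ⟶ es s u
dB₀ s u = transport (λ z → app (lam s) u ⟶ es s z) (rename-+0 u) (root (dB [] s u))

plugL-++ : ∀ L₁ L₂ t → plugL (L₁ ++ L₂) t ≡ plugL L₁ (plugL L₂ t)
plugL-++ []       L₂ t = refl
plugL-++ (s ∷ L₁) L₂ t = cong (λ x → es x s) (plugL-++ L₁ L₂ t)

compV : VCtx → VCtx → VCtx
compV hole       V₂ = V₂
compV (appL V s) V₂ = appL (compV V V₂) s
compV (appR s V) V₂ = appR s (compV V V₂)
compV (esL V s)  V₂ = esL (compV V V₂) s
compV (esR s V)  V₂ = esR s (compV V V₂)

plugV-compV : ∀ V₁ V₂ t → plugV (compV V₁ V₂) t ≡ plugV V₁ (plugV V₂ t)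
plugV-compV hole       V₂ t = refl
plugV-compV (appL V s) V₂ t = cong (λ x → app x s) (plugV-compV V V₂ t)
plugV-compV (appR s V) V₂ t = cong (app s) (plugV-compV V V₂ t)
plugV-compV (esL V s)  V₂ t = cong (λ x → es x s) (plugV-compV V V₂ t)
plugV-compV (esR s V)  V₂ t = cong (es s) (plugV-compV V V₂ t)

chainV : LCtx → VCtx
chainV []      = hole
chainV (s ∷ L) = esL (chainV L) s

plugV-chainV : ∀ L t → plugV (chainV L) t ≡ plugL L t
plugV-chainV []      t = refl
plugV-chainV (s ∷ L) t = cong (λ x → es x s) (plugV-chainV L t)

plugL-plugV : ∀ L V t → plugL L (plugV V t) ≡ plugV (compV (chainV L) V) t
plugL-plugV L V t = trans (sym (plugV-chainV L _)) (sym (plugV-compV (chainV L) V t))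

substV : (ℕ → Term) → VCtx → VCtx
substV σ hole       = hole
substV σ (appL V s) = appL (substV σ V) (subst σ s)
substV σ (appR s V) = appR (subst σ s) (substV σ V)
substV σ (esL V s)  = esL (substV (exts σ) V) (subst σ s)
substV σ (esR s V)  = esR (subst (exts σ) s) (substV σ V)

holeSubV : (ℕ → Term) → VCtx → ℕ → Term
holeSubV σ hole       = σ
holeSubV σ (appL V s) = holeSubV σ V
holeSubV σ (appR s V) = holeSubV σ V
holeSubV σ (esL V s)  = holeSubV (exts σ) V
holeSubV σ (esR s V)  = holeSubV σ V

holeSubV-ValueSub : ∀ V {σ} → ValueSub σ → ValueSub (holeSubV σ V)
holeSubV-ValueSub hole       vσ = vσ
holeSubV-ValueSub (appL V s) vσ = holeSubV-ValueSub V vσ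
holeSubV-ValueSub (appR s V) vσ = holeSubV-ValueSub V vσ
holeSubV-ValueSub (esL V s)  vσ = holeSubV-ValueSub V (exts-ValueSub vσ)
holeSubV-ValueSub (esR s V)  vσ = holeSubV-ValueSub V vσ

subst-plugV : ∀ σ V t → subst σ (plugV V t) ≡ plugV (substV σ V) (subst (holeSubV σ V) t)
subst-plugV σ hole       t = refl
subst-plugV σ (appL V s) t = cong (λ x → app x (subst σ s)) (subst-plugV σ V t)
subst-plugV σ (appR s V) t = cong (app (subst σ s)) (subst-plugV σ V t)
subst-plugV σ (esL V s)  t = cong (λ x → es x (subst σ s)) (subst-plugV (exts σ) V t)
subst-plugV σ (esR s V)  t = cong (es (subst (exts σ) s)) (subst-plugV σ V t)

data WCtx : Set where
  hole : WCtx
  wapp : WCtx → Term → WCtx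
  wes  : WCtx → Term → WCtx

plugW : WCtx → Term → Term
plugW hole       t = t
plugW (wapp W u) t = app (plugW W t) u
plugW (wes W u)  t = es (plugW W t) u

⟶-plugW : ∀ W {s s'} → s ⟶ s' → plugW W s ⟶ plugW W s'
⟶-plugW hole       st = st
⟶-plugW (wapp W u) st = appl (⟶-plugW W st)
⟶-plugW (wes W u)  st = esl (⟶-plugW W st)

compW : WCtx → WCtx → WCtx
compW hole       W₂ = W₂
compW (wapp W u) W₂ = wapp (compW W W₂) u
compW (wes W u)  W₂ = wes (compW W W₂) u

plugW-compW : ∀ W₁ W₂ t → plugW (compW W₁ W₂) t ≡ plugW W₁ (plugW W₂ t)
plugW-compW hole       W₂ t = refl
plugW-compW (wapp W u) W₂ t = cong (λ x → app x u) (plugW-compW W W₂ t)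
plugW-compW (wes W u)  W₂ t = cong (λ x → es x u) (plugW-compW W W₂ t)

chainW : LCtx → WCtx
chainW []      = hole
chainW (s ∷ L) = wes (chainW L) s

plugW-chainW : ∀ L t → plugW (chainW L) t ≡ plugL L t
plugW-chainW []      t = refl
plugW-chainW (s ∷ L) t = cong (λ x → es x s) (plugW-chainW L t)

plugW-compW-chainW : ∀ W L t → plugW (compW W (chainW L)) t ≡ plugW W (plugL L t)
plugW-compW-chainW W L t = trans (plugW-compW W (chainW L) t) (cong (plugW W) (plugW-chainW L t))

plugL-plugW : ∀ L W t → plugL L (plugW W t) ≡ plugW (compW (chainW L) W) t
plugL-plugW L W t = trans (sym (plugW-chainW L _)) (sym (plugW-compW (chainW L) W t))

toTCtx : WCtx → TCtx
toTCtx hole       = hole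
toTCtx (wapp W u) = appT (toTCtx W) u
toTCtx (wes W u)  = redex (toTCtx W) u

plugT-toTCtx : ∀ W t → plugT (toTCtx W) t ⟶* plugW W t
plugT-toTCtx hole       t = ε
plugT-toTCtx (wapp W u) t = gmap (λ x → app x u) appl (plugT-toTCtx W t)
plugT-toTCtx (wes W u)  t = dB₀ _ u ◅ gmap (λ x → es x u) esl (plugT-toTCtx W t)

WMeaningful : Term → Set
WMeaningful q = Σ WCtx λ W → Σ Term λ v → Value v × plugW W q ⟶* v

WMeaningful⇒Meaningful : ∀ {q} → WMeaningful q → Meaningful q
WMeaningful⇒Meaningful {q} (W , v , vv , red) =
  toTCtx W , v , vv , ⟶*⇒→v* (plugT-toTCtx W q ◅◅ red)

WMeaningful-value : ∀ {v} → Value v → WMeaningful v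
WMeaningful-value vv = hole , _ , vv , ε

WMeaningful-expand : ∀ {q q'} → q ⟶ q' → WMeaningful q' → WMeaningful q
WMeaningful-expand st (W , v , vv , red) = W , v , vv , (⟶-plugW W st ◅ red)

WMeaningful-app⁻ : ∀ {q c} → WMeaningful (app q c) → WMeaningful q
WMeaningful-app⁻ {q} {c} (W , v , vv , red) =
  compW W (wapp hole c) , v , vv , subst₂ _⟶*_ (sym (plugW-compW W (wapp hole c) q)) refl red

-- Meaningfulness is reflected by substitutions of values

restrictSub : ℕ → (ℕ → Term) → ℕ → Term
restrictSub zero    ρ i       = var i
restrictSub (suc k) ρ zero    = ρ 0
restrictSub (suc k) ρ (suc i) = restrictSub k (ρ ∘ suc) i

restrictSub-+ : ∀ k ρ i → restrictSub k ρ (i + k) ≡ var i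
restrictSub-+ zero    ρ i = cong var (+-identityʳ i)
restrictSub-+ (suc k) ρ i = trans (cong (restrictSub (suc k) ρ) (+-suc i k)) (restrictSub-+ k (ρ ∘ suc) i)

restrictSub-< : ∀ k ρ i → i < k → restrictSub k ρ i ≡ ρ i
restrictSub-< (suc k) ρ zero    _       = refl
restrictSub-< (suc k) ρ (suc i) (s≤s p) = restrictSub-< k (ρ ∘ suc) i p

esChain : ℕ → (ℕ → Term) → LCtx
esChain zero    ρ = []
esChain (suc k) ρ = esChain k (ρ ∘ suc) ++ [ rename (_+ k) (ρ 0) ]

esChain-⟶* : ∀ k ρ → ValueSub ρ → ∀ a → plugL (esChain k ρ) a ⟶* subst (restrictSub k ρ) a
esChain-⟶* zero ρ vρ a = subst₂ _⟶*_ refl (sym (subst-var a)) ε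
esChain-⟶* (suc k) ρ vρ a =
  subst₂ _⟶*_ (sym (plugL-++ (esChain k (ρ ∘ suc)) [ c ] a)) (subst-sv-sub a)
    (gmap (plugL (esChain k (ρ ∘ suc))) (⟶-plugL (esChain k (ρ ∘ suc)))
          (root (sv [] a c (Value-rename _ (vρ 0))) ◅ ε)
     ◅◅ esChain-⟶* k (ρ ∘ suc) (vρ ∘ suc) (subst (sv-sub c 0) a))
  where
  c = rename (_+ k) (ρ 0)
  sv-then-restrict : subst (restrictSub k (ρ ∘ suc)) ∘ sv-sub c 0 ≗ restrictSub (suc k) ρ
  sv-then-restrict zero    = begin
    subst (restrictSub k (ρ ∘ suc)) (rename (_+ k) (ρ 0)) ≡⟨ subst-rename _ (_+ k) (ρ 0) ⟩
    subst (restrictSub k (ρ ∘ suc) ∘ (_+ k)) (ρ 0)         ≡⟨ subst-cong (restrictSub-+ k (ρ ∘ suc)) (ρ 0) ⟩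
    subst var (ρ 0)                                        ≡⟨ subst-var (ρ 0) ⟩
    ρ 0                                                    ∎
    where open ≡-Reasoning
  sv-then-restrict (suc i) = cong (restrictSub k (ρ ∘ suc)) (+-identityʳ i)
  subst-sv-sub : ∀ a → subst (restrictSub k (ρ ∘ suc)) (subst (sv-sub c 0) a) ≡ subst (restrictSub (suc k) ρ) a
  subst-sv-sub a = trans (subst-subst _ _ a) (subst-cong sv-then-restrict a)

data Scoped : ℕ → Term → Set where
  svar : ∀ {k n}   → n < k → Scoped k (var n)
  slam : ∀ {k t}   → Scoped (suc k) t → Scoped k (lam t)
  sapp : ∀ {k t u} → Scoped k t → Scoped k u → Scoped k (app t u)
  ses  : ∀ {k t u} → Scoped (suc k) t → Scoped k u → Scoped k (es t u)

Scoped-weaken : ∀ {k k' t} → k ≤ k' → Scoped k t → Scoped k' t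
Scoped-weaken p (svar q)     = svar (≤-trans q p)
Scoped-weaken p (slam s)     = slam (Scoped-weaken (s≤s p) s)
Scoped-weaken p (sapp s₁ s₂) = sapp (Scoped-weaken p s₁) (Scoped-weaken p s₂)
Scoped-weaken p (ses s₁ s₂)  = ses (Scoped-weaken (s≤s p) s₁) (Scoped-weaken p s₂)

scoped : ∀ t → Σ ℕ λ k → Scoped k t
scoped (var n) = suc n , svar ≤-refl
scoped (lam t) with scoped t
... | k , s = k , slam (Scoped-weaken (n≤1+n k) s)
scoped (app t u) with scoped t | scoped u
... | k₁ , s₁ | k₂ , s₂ = k₁ ⊔ k₂ , sapp (Scoped-weaken (m≤m⊔n k₁ k₂) s₁) (Scoped-weaken (m≤n⊔m k₁ k₂) s₂)
scoped (es t u) with scoped t | scoped u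
... | k₁ , s₁ | k₂ , s₂ =
  k₁ ⊔ k₂ , ses (Scoped-weaken (≤-trans (m≤m⊔n k₁ k₂) (n≤1+n _)) s₁) (Scoped-weaken (m≤n⊔m k₁ k₂) s₂)

AgreeBelow : ℕ → (ℕ → Term) → (ℕ → Term) → Set
AgreeBelow k σ σ' = ∀ i → i < k → σ i ≡ σ' i

exts-AgreeBelow : ∀ {k σ σ'} → AgreeBelow k σ σ' → AgreeBelow (suc k) (exts σ) (exts σ')
exts-AgreeBelow e zero    _       = refl
exts-AgreeBelow e (suc i) (s≤s p) = cong (rename suc) (e i p)

subst-cong-Scoped : ∀ {k t σ σ'} → Scoped k t → AgreeBelow k σ σ' → subst σ t ≡ subst σ' t
subst-cong-Scoped (svar p)     e = e _ p
subst-cong-Scoped (slam s)     e = cong lam (subst-cong-Scoped s (exts-AgreeBelow e))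
subst-cong-Scoped (sapp s₁ s₂) e = cong₂ app (subst-cong-Scoped s₁ e) (subst-cong-Scoped s₂ e)
subst-cong-Scoped (ses s₁ s₂)  e = cong₂ es (subst-cong-Scoped s₁ (exts-AgreeBelow e)) (subst-cong-Scoped s₂ e)

-- Only finitely many variables of a are free, so ρ can be realised by a finite chain of
-- explicit substitutions, which the weak context absorbs.
WMeaningful-unsubst : ∀ ρ → ValueSub ρ → ∀ a → WMeaningful (subst ρ a) → WMeaningful a
WMeaningful-unsubst ρ vρ a (W , r , vr , red) with scoped a
... | k , sc = compW W (chainW (esChain k ρ)) , r , vr ,
  subst₂ _⟶*_ (sym (plugW-compW-chainW W (esChain k ρ) a)) refl
    (gmap (plugW W) (⟶-plugW W) (esChain-⟶* k ρ vρ a) ◅◅ subst₂ _⟶*_ (cong (plugW W) restrict) refl red)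
  where
  restrict : subst ρ a ≡ subst (restrictSub k ρ) a
  restrict = subst-cong-Scoped sc (λ i p → sym (restrictSub-< k ρ i p))

keepES : WCtx → WCtx
keepES hole       = hole
keepES (wapp W u) = keepES W
keepES (wes W u)  = wes (keepES W) u

keepES-compW : ∀ W₁ W₂ → keepES (compW W₁ W₂) ≡ compW (keepES W₁) (keepES W₂)
keepES-compW hole       W₂ = refl
keepES-compW (wapp W u) W₂ = keepES-compW W W₂
keepES-compW (wes W u)  W₂ = cong (λ x → wes x u) (keepES-compW W W₂)

keepES-chainW : ∀ L → keepES (chainW L) ≡ chainW L
keepES-chainW []      = refl
keepES-chainW (s ∷ L) = cong (λ x → wes x s) (keepES-chainW L)

substW : (ℕ → Term) → WCtx → WCtx
substW σ hole       = hole
substW σ (wapp W u) = wapp (substW σ W) (subst σ u)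
substW σ (wes W u)  = wes (substW (exts σ) W) (subst σ u)

holeSubW : (ℕ → Term) → WCtx → ℕ → Term
holeSubW σ hole       = σ
holeSubW σ (wapp W u) = holeSubW σ W
holeSubW σ (wes W u)  = holeSubW (exts σ) W

holeSubW-ValueSub : ∀ W {σ} → ValueSub σ → ValueSub (holeSubW σ W)
holeSubW-ValueSub hole       vσ = vσ
holeSubW-ValueSub (wapp W u) vσ = holeSubW-ValueSub W vσ
holeSubW-ValueSub (wes W u)  vσ = holeSubW-ValueSub W (exts-ValueSub vσ)

subst-plugW : ∀ σ W t → subst σ (plugW W t) ≡ plugW (substW σ W) (subst (holeSubW σ W) t)
subst-plugW σ hole       t = refl
subst-plugW σ (wapp W u) t = cong (λ x → app x (subst σ u)) (subst-plugW σ W t)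
subst-plugW σ (wes W u)  t = cong (λ x → es x (subst σ u)) (subst-plugW (exts σ) W t)

keepES-substW : ∀ σ W → keepES (substW σ W) ≡ substW σ (keepES W)
keepES-substW σ hole       = refl
keepES-substW σ (wapp W u) = keepES-substW σ W
keepES-substW σ (wes W u)  = cong (λ x → wes x (subst σ u)) (keepES-substW (exts σ) W)

holeSubW-keepES : ∀ σ W → holeSubW σ (keepES W) ≡ holeSubW σ W
holeSubW-keepES σ hole       = refl
holeSubW-keepES σ (wapp W u) = holeSubW-keepES σ W
holeSubW-keepES σ (wes W u)  = holeSubW-keepES (exts σ) W

subst-plugW-keepES : ∀ σ W t →
  subst σ (plugW (keepES W) t) ≡ plugW (keepES (substW σ W)) (subst (holeSubW σ W) t)
subst-plugW-keepES σ W t = trans (subst-plugW σ (keepES W) t)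
  (cong₂ (λ W' σ' → plugW W' (subst σ' t)) (sym (keepES-substW σ W)) (holeSubW-keepES σ W))

plugW≡plugL⁻ : ∀ W w L {x} → Value x → plugW W w ≡ plugL L x →
  Σ LCtx λ L₁ → Σ LCtx λ L₂ → L ≡ L₁ ++ L₂ × W ≡ chainW L₁ × w ≡ plugL L₂ x
plugW≡plugL⁻ hole       w L       vx e  = [] , L , refl , refl , e
plugW≡plugL⁻ (wapp W u) w []      () refl
plugW≡plugL⁻ (wapp W u) w (s ∷ L) vx ()
plugW≡plugL⁻ (wes W u)  w []      () refl
plugW≡plugL⁻ (wes W u)  w (s ∷ L) vx e with plugW≡plugL⁻ W w L vx (es-injectiveˡ e)
... | L₁ , L₂ , refl , refl , e₂ = s ∷ L₁ , L₂ , refl , cong (wes (chainW L₁)) (es-injectiveʳ e) , e₂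

KeepESTracks : Term → WCtx → Term → Set
KeepESTracks s₁ W v = Σ WCtx λ W₁ → Σ Term λ w₁ → Σ Term λ v₁ →
  Value v₁ × s₁ ≡ plugW W₁ w₁ × plugW (keepES W) v ⟶* plugW (keepES W₁) v₁

keepES-chainW-compW : ∀ L W → keepES (compW (chainW L) W) ≡ compW (chainW L) (keepES W)
keepES-chainW-compW L W = trans (keepES-compW (chainW L) W) (cong (λ W' → compW W' (keepES W)) (keepES-chainW L))

keepES-sv : ∀ L W w {v v'} → Value v → Value v' →
  KeepESTracks (plugL L (subst (sv-sub v' (length L)) (plugW W w))) (wes W (plugL L v')) v
keepES-sv L W w {v} {v'} vv vv' =
  compW (chainW L) (substW σ W) , subst (holeSubW σ W) w , v₁ ,
  Value-subst (holeSubW-ValueSub W (sv-sub-ValueSub vv' (length L))) vv ,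
  trans (cong (plugL L) (subst-plugW σ W w)) (plugL-plugW L (substW σ W) _) ,
  (root (sv L (plugW (keepES W) v) v' vv') ◅ subst₂ _⟶*_ refl keepES-reduct ε)
  where
  σ = sv-sub v' (length L)
  v₁ = subst (holeSubW σ W) v
  keepES-reduct : plugL L (subst σ (plugW (keepES W) v)) ≡ plugW (keepES (compW (chainW L) (substW σ W))) v₁
  keepES-reduct = begin
    plugL L (subst σ (plugW (keepES W) v))            ≡⟨ cong (plugL L) (subst-plugW-keepES σ W v) ⟩
    plugL L (plugW (keepES (substW σ W)) v₁)          ≡⟨ plugL-plugW L _ v₁ ⟩
    plugW (compW (chainW L) (keepES (substW σ W))) v₁ ≡⟨ cong (λ W' → plugW W' v₁)
                                                              (sym (keepES-chainW-compW L (substW σ W))) ⟩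
    plugW (keepES (compW (chainW L) (substW σ W))) v₁ ∎
    where open ≡-Reasoning

-- Every step of W⟨w⟩ is matched by at most one step of (keepES W)⟨v⟩: steps inside w or inside
-- an argument are dropped, a dB-step at an application of W removes that application, and an
-- sv-step at a substitution of W is performed on both sides.
keepES-step : ∀ {s s₁} → s ⟶ s₁ → ∀ W w {v} → Value v → s ≡ plugW W w → KeepESTracks s₁ W v
keepES-step st hole w {v} vv e = hole , _ , v , vv , refl , ε
keepES-step (appl st) (wapp W u) w vv refl with keepES-step st W w vv refl
... | W₁ , w₁ , v₁ , vv₁ , e , red = wapp W₁ u , w₁ , v₁ , vv₁ , cong (λ x → app x u) e , red
keepES-step (appr st) (wapp W u) w {v} vv refl = wapp W _ , w , v , vv , refl , ε
keepES-step (root (dB L t c)) (wapp W u) w {v} vv e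
  with plugW≡plugL⁻ W w L (vlam t) (sym (app-injectiveˡ e))
... | L₁ , L₂ , refl , refl , refl =
  chainW L₁ , _ , v , vv , trans (plugL-++ L₁ L₂ _) (sym (plugW-chainW L₁ _)) , ε
keepES-step (root (sv L t v' vv')) (wapp W u) w vv ()
keepES-step (root (dB L t c)) (wes W u) w vv ()
keepES-step (esl st) (wes W u) w vv refl with keepES-step st W w vv refl
... | W₁ , w₁ , v₁ , vv₁ , e , red =
  wes W₁ u , w₁ , v₁ , vv₁ , cong (λ x → es x u) e , gmap (λ x → es x u) esl red
keepES-step (esr st) (wes W u) w {v} vv refl = wes W _ , w , v , vv , refl , (esr st ◅ ε)
keepES-step (root (sv L _ v' vv')) (wes W _) w vv refl = keepES-sv L W w vv vv'

keepES-reaches-value : ∀ {s r} → s ⟶* r → Value r → ∀ W w {v} → Value v → s ≡ plugW W w →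
  Σ Term λ v' → Value v' × plugW (keepES W) v ⟶* v'
keepES-reaches-value ε vr hole w {v} vv e = v , vv , ε
keepES-reaches-value ε () (wapp W u) w vv refl
keepES-reaches-value ε () (wes W u) w vv refl
keepES-reaches-value (st ◅ red) vr W w vv e with keepES-step st W w vv e
... | W₁ , w₁ , v₁ , vv₁ , e₁ , red₁ with keepES-reaches-value red vr W₁ w₁ vv₁ e₁
... | v' , vv' , red' = v' , vv' , (red₁ ◅◅ red')

WMeaningful-plugL-value : ∀ L w {v} → Value v → WMeaningful (plugL L w) → WMeaningful (plugL L v)
WMeaningful-plugL-value L w {v} vv (W , r , vr , red)
  with keepES-reaches-value red vr (compW W (chainW L)) w vv (sym (plugW-compW-chainW W L w))
... | v' , vv' , red' = keepES W , v' , vv' , subst₂ _⟶*_ keepES-plug refl red'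
  where
  keepES-plug : plugW (keepES (compW W (chainW L))) v ≡ plugW (keepES W) (plugL L v)
  keepES-plug = trans (cong (λ W' → plugW W' v)
                        (trans (keepES-compW W (chainW L)) (cong (compW (keepES W)) (keepES-chainW L))))
                      (plugW-compW-chainW (keepES W) L v)

-- Ω in surface position blocks reduction to a value

δ : Term
δ = lam (app (var 0) (var 0))

Ω : Term
Ω = app δ δ

Ω' : Term
Ω' = es (app (var 0) (var 0)) δ

data SurfaceΩ : Term → Set where
  isΩ  : SurfaceΩ Ω
  isΩ' : SurfaceΩ Ω'
  appˡ : ∀ {s u} → SurfaceΩ s → SurfaceΩ (app s u)
  appʳ : ∀ {s u} → SurfaceΩ u → SurfaceΩ (app s u)
  esˡ  : ∀ {s u} → SurfaceΩ s → SurfaceΩ (es s u)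
  esʳ  : ∀ {s u} → SurfaceΩ u → SurfaceΩ (es s u)

SurfaceΩ-subst : ∀ σ {s} → SurfaceΩ s → SurfaceΩ (subst σ s)
SurfaceΩ-subst σ isΩ      = isΩ
SurfaceΩ-subst σ isΩ'     = isΩ'
SurfaceΩ-subst σ (appˡ h) = appˡ (SurfaceΩ-subst σ h)
SurfaceΩ-subst σ (appʳ h) = appʳ (SurfaceΩ-subst σ h)
SurfaceΩ-subst σ (esˡ h)  = esˡ (SurfaceΩ-subst (exts σ) h)
SurfaceΩ-subst σ (esʳ h)  = esʳ (SurfaceΩ-subst σ h)

SurfaceΩ-rename : ∀ ρ {s} → SurfaceΩ s → SurfaceΩ (rename ρ s)
SurfaceΩ-rename ρ {s} h = transport SurfaceΩ (sym (rename≗subst-var ρ s)) (SurfaceΩ-subst (var ∘ ρ) h)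

SurfaceΩ-plugL : ∀ L {s} → SurfaceΩ s → SurfaceΩ (plugL L s)
SurfaceΩ-plugL []      h = h
SurfaceΩ-plugL (u ∷ L) h = esˡ (SurfaceΩ-plugL L h)

SurfaceΩ-plugV : ∀ V {s} → SurfaceΩ s → SurfaceΩ (plugV V s)
SurfaceΩ-plugV hole       h = h
SurfaceΩ-plugV (appL V u) h = appˡ (SurfaceΩ-plugV V h)
SurfaceΩ-plugV (appR u V) h = appʳ (SurfaceΩ-plugV V h)
SurfaceΩ-plugV (esL V u)  h = esˡ (SurfaceΩ-plugV V h)
SurfaceΩ-plugV (esR u V)  h = esʳ (SurfaceΩ-plugV V h)

¬SurfaceΩ-value : ∀ {v} → Value v → ¬ SurfaceΩ v
¬SurfaceΩ-value (vvar n) ()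
¬SurfaceΩ-value (vlam t) ()

SurfaceΩ-plugL-value : ∀ L {x} y → Value x → SurfaceΩ (plugL L x) → SurfaceΩ (plugL L y)
SurfaceΩ-plugL-value []            y vx h        = ⊥-elim (¬SurfaceΩ-value vx h)
SurfaceΩ-plugL-value (s ∷ [])      y vx (esˡ h)  = ⊥-elim (¬SurfaceΩ-value vx h)
SurfaceΩ-plugL-value (s ∷ s' ∷ L)  y vx (esˡ h)  = esˡ (SurfaceΩ-plugL-value (s' ∷ L) y vx h)
SurfaceΩ-plugL-value (s ∷ L)       y vx (esʳ h)  = esʳ h

var-irreducible : ∀ {n s} → ¬ (var n ⟶ s)
var-irreducible (root ())

app-var-irreducible : ∀ {s s' n m} → s ⟶ s' → s ≢ app (var n) (var m)
app-var-irreducible (root (dB [] _ _))      ()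
app-var-irreducible (root (dB (_ ∷ _) _ _)) ()
app-var-irreducible (appl st)               refl = var-irreducible st
app-var-irreducible (appr st)               refl = var-irreducible st

SurfaceΩ-↦ : ∀ {s s₁} → s ↦ s₁ → SurfaceΩ s → SurfaceΩ s₁
SurfaceΩ-↦ (dB [] t u)   isΩ      = isΩ'
SurfaceΩ-↦ (dB L t u)    (appˡ h) = SurfaceΩ-plugL-value L _ (vlam t) h
SurfaceΩ-↦ (dB L t u)    (appʳ h) = SurfaceΩ-plugL L (esʳ (SurfaceΩ-rename _ h))
SurfaceΩ-↦ (sv [] t v _) isΩ'     = isΩ
SurfaceΩ-↦ (sv L t v _)  (esˡ h)  = SurfaceΩ-plugL L (SurfaceΩ-subst _ h)
SurfaceΩ-↦ (sv L t v vv) (esʳ h)  = SurfaceΩ-plugL-value L _ vv h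

SurfaceΩ-step : ∀ {s s₁} → s ⟶ s₁ → SurfaceΩ s → SurfaceΩ s₁
SurfaceΩ-step (root r)         h        = SurfaceΩ-↦ r h
SurfaceΩ-step (appl st)        (appˡ h) = appˡ (SurfaceΩ-step st h)
SurfaceΩ-step (appl st)        (appʳ h) = appʳ h
SurfaceΩ-step (appl (root ())) isΩ
SurfaceΩ-step (appr st)        (appˡ h) = appˡ h
SurfaceΩ-step (appr st)        (appʳ h) = appʳ (SurfaceΩ-step st h)
SurfaceΩ-step (appr (root ())) isΩ
SurfaceΩ-step (esl st)         (esˡ h)  = esˡ (SurfaceΩ-step st h)
SurfaceΩ-step (esl st)         (esʳ h)  = esʳ h
SurfaceΩ-step (esl st)         isΩ'     = ⊥-elim (app-var-irreducible st refl)
SurfaceΩ-step (esr st)         (esˡ h)  = esˡ h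
SurfaceΩ-step (esr st)         (esʳ h)  = esʳ (SurfaceΩ-step st h)
SurfaceΩ-step (esr (root ()))  isΩ'

SurfaceΩ-¬⟶*value : ∀ {s v} → SurfaceΩ s → s ⟶* v → ¬ Value v
SurfaceΩ-¬⟶*value h ε           vv = ¬SurfaceΩ-value vv h
SurfaceΩ-¬⟶*value h (st ◅ red) vv = SurfaceΩ-¬⟶*value (SurfaceΩ-step st h) red vv

infix 4 _∼_

data _∼_ : Term → Term → Set where
  ∼var  : ∀ n → var n ∼ var n
  ∼lam  : ∀ {a b} → a ∼ b → lam a ∼ lam b
  ∼app  : ∀ {a b c d} → a ∼ b → c ∼ d → app a c ∼ app b d
  ∼es   : ∀ {a b c d} → a ∼ b → c ∼ d → es a c ∼ es b d
  ∼inst : ∀ {s s'} a b ρ ρ' → ¬ WMeaningful a → ValueSub ρ → (∀ i → ρ i ∼ ρ' i) →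
          s ≡ subst ρ a → s' ≡ subst ρ' b → s ∼ s'

∼-refl : ∀ s → s ∼ s
∼-refl (var n)   = ∼var n
∼-refl (lam s)   = ∼lam (∼-refl s)
∼-refl (app s u) = ∼app (∼-refl s) (∼-refl u)
∼-refl (es s u)  = ∼es (∼-refl s) (∼-refl u)

∼-meaningless : ∀ {a ρ s} → ¬ WMeaningful a → ValueSub ρ → s ≡ subst ρ a → ∀ b → s ∼ subst ρ b
∼-meaningless {a} {ρ} nm vρ e b = ∼inst a b ρ ρ nm vρ (∼-refl ∘ ρ) e refl

∼-rename : ∀ ρ {s s'} → s ∼ s' → rename ρ s ∼ rename ρ s'
∼-rename ρ (∼var n)     = ∼var _
∼-rename ρ (∼lam r)     = ∼lam (∼-rename (ext ρ) r)
∼-rename ρ (∼app r₁ r₂) = ∼app (∼-rename ρ r₁) (∼-rename ρ r₂)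
∼-rename ρ (∼es r₁ r₂)  = ∼es (∼-rename (ext ρ) r₁) (∼-rename ρ r₂)
∼-rename ρ (∼inst a b σ σ' nm vσ rσ refl refl) =
  ∼inst a b (rename ρ ∘ σ) (rename ρ ∘ σ') nm (Value-rename ρ ∘ vσ) (∼-rename ρ ∘ rσ)
        (rename-subst ρ σ a) (rename-subst ρ σ' b)

exts-∼ : ∀ {θ θ'} → (∀ i → θ i ∼ θ' i) → ∀ i → exts θ i ∼ exts θ' i
exts-∼ rθ zero    = ∼var 0
exts-∼ rθ (suc i) = ∼-rename suc (rθ i)

∼-subst : ∀ {θ θ'} → ValueSub θ → (∀ i → θ i ∼ θ' i) → ∀ {s s'} → s ∼ s' → subst θ s ∼ subst θ' s'
∼-subst vθ rθ (∼var n)     = rθ n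
∼-subst vθ rθ (∼lam r)     = ∼lam (∼-subst (exts-ValueSub vθ) (exts-∼ rθ) r)
∼-subst vθ rθ (∼app r₁ r₂) = ∼app (∼-subst vθ rθ r₁) (∼-subst vθ rθ r₂)
∼-subst vθ rθ (∼es r₁ r₂)  = ∼es (∼-subst (exts-ValueSub vθ) (exts-∼ rθ) r₁) (∼-subst vθ rθ r₂)
∼-subst {θ} {θ'} vθ rθ (∼inst a b σ σ' nm vσ rσ refl refl) =
  ∼inst a b (subst θ ∘ σ) (subst θ' ∘ σ') nm (Value-subst vθ ∘ vσ) (∼-subst vθ rθ ∘ rσ)
        (subst-subst θ σ a) (subst-subst θ' σ' b)

∼-plugL : ∀ {L L'} → Pointwise _∼_ L L' → ∀ {x y} → x ∼ y → plugL L x ∼ plugL L' y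
∼-plugL []         r = r
∼-plugL (r' ∷ rL) r = ∼es (∼-plugL rL r) r'

∼-plugV : ∀ V {x y} → x ∼ y → plugV V x ∼ plugV V y
∼-plugV hole       r = r
∼-plugV (appL V s) r = ∼app (∼-plugV V r) (∼-refl s)
∼-plugV (appR s V) r = ∼app (∼-refl s) (∼-plugV V r)
∼-plugV (esL V s)  r = ∼es (∼-plugV V r) (∼-refl s)
∼-plugV (esR s V)  r = ∼es (∼-refl s) (∼-plugV V r)

∼-plugF : ∀ F {x y} → x ∼ y → plugF F x ∼ plugF F y
∼-plugF hole       r = r
∼-plugF (appL F s) r = ∼app (∼-plugF F r) (∼-refl s)
∼-plugF (appR s F) r = ∼app (∼-refl s) (∼-plugF F r)
∼-plugF (lamF F)   r = ∼lam (∼-plugF F r)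
∼-plugF (esL F s)  r = ∼es (∼-plugF F r) (∼-refl s)
∼-plugF (esR s F)  r = ∼es (∼-refl s) (∼-plugF F r)

∼-plugT : ∀ T {x y} → x ∼ y → plugT T x ∼ plugT T y
∼-plugT hole        r = r
∼-plugT (appT T u)  r = ∼app (∼-plugT T r) (∼-refl u)
∼-plugT (redex T u) r = ∼app (∼lam (∼-plugT T r)) (∼-refl u)

data MeaninglessAtSurface (s : Term) : Set where
  at : ∀ V a ρ → ¬ WMeaningful a → ValueSub ρ → s ≡ plugV V (subst ρ a) → MeaninglessAtSurface s

MeaninglessAtSurface-plugV : ∀ V {s} → MeaninglessAtSurface s → MeaninglessAtSurface (plugV V s)
MeaninglessAtSurface-plugV V (at V₁ a ρ nm vρ e) =
  at (compV V V₁) a ρ nm vρ (trans (cong (plugV V) e) (sym (plugV-compV V V₁ _)))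

MeaninglessAtSurface-plugL : ∀ L {s} → MeaninglessAtSurface s → MeaninglessAtSurface (plugL L s)
MeaninglessAtSurface-plugL L {s} m =
  transport MeaninglessAtSurface (plugV-chainV L s) (MeaninglessAtSurface-plugV (chainV L) m)

∼-plugL⁻ : ∀ L {x y} → plugL L x ∼ y →
  (Σ LCtx λ L' → Σ Term λ y₀ → y ≡ plugL L' y₀ × Pointwise _∼_ L L' × x ∼ y₀) ⊎ MeaninglessAtSurface (plugL L x)
∼-plugL⁻ []      {y = y} r = inj₁ ([] , y , refl , [] , r)
∼-plugL⁻ (s ∷ L) (∼es {d = d} r₁ r₂) with ∼-plugL⁻ L r₁
... | inj₁ (L' , y₀ , e , rL , r) = inj₁ (d ∷ L' , y₀ , cong (λ z → es z d) e , r₂ ∷ rL , r)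
... | inj₂ m                      = inj₂ (MeaninglessAtSurface-plugV (esL hole s) m)
∼-plugL⁻ (s ∷ L) (∼inst a b ρ ρ' nm vρ rρ e e') = inj₂ (at hole a ρ nm vρ e)

∼-value⁻ : ∀ {v y} → Value v → v ∼ y → Value y ⊎ MeaninglessAtSurface v
∼-value⁻ (vvar n) (∼var n) = inj₁ (vvar n)
∼-value⁻ (vlam t) (∼lam r) = inj₁ (vlam _)
∼-value⁻ vv (∼inst a b ρ ρ' nm vρ rρ e e') = inj₂ (at hole a ρ nm vρ e)

Matched : Term → Term → Set
Matched s' s₁ = Σ Term λ s₁' → s' ⟶ s₁' × s₁ ∼ s₁'

∼-dB : ∀ L t u {f' u'} → plugL L (lam t) ∼ f' → u ∼ u' →
  Matched (app f' u') (plugL L (es t (rename (_+ length L) u))) ⊎ MeaninglessAtSurface (app (plugL L (lam t)) u)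
∼-dB L t u {u' = u'} rf ru with ∼-plugL⁻ L rf
... | inj₂ m = inj₂ (MeaninglessAtSurface-plugV (appL hole u) m)
... | inj₁ (L' , _ , refl , rL , ∼inst a b ρ ρ' nm vρ rρ e e') =
  inj₂ (MeaninglessAtSurface-plugV (appL hole u) (MeaninglessAtSurface-plugL L (at hole a ρ nm vρ e)))
... | inj₁ (L' , _ , refl , rL , ∼lam {b = t'} rt) = inj₁ (_ , root (dB L' t' _) , ∼-plugL rL (∼es rt ru↑))
  where
  ru↑ : rename (_+ length L) u ∼ rename (_+ length L') u'
  ru↑ = transport (λ k → rename (_+ length L) u ∼ rename (_+ k) u') (Pointwise-length rL) (∼-rename _ ru)

∼-sv : ∀ L t v → Value v → ∀ {t' x'} → t ∼ t' → plugL L v ∼ x' →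
  Matched (es t' x') (plugL L (subst (sv-sub v (length L)) t)) ⊎ MeaninglessAtSurface (es t (plugL L v))
∼-sv L t v vv {t'} rt rx with ∼-plugL⁻ L rx
... | inj₂ m = inj₂ (MeaninglessAtSurface-plugV (esR t hole) m)
... | inj₁ (L' , v' , refl , rL , rv) with ∼-value⁻ vv rv
...   | inj₂ m   = inj₂ (MeaninglessAtSurface-plugV (esR t hole) (MeaninglessAtSurface-plugL L m))
...   | inj₁ vv' = inj₁ (_ , root (sv L' _ v' vv') , ∼-plugL rL rbody)
  where
  rsv : ∀ i → sv-sub v (length L) i ∼ sv-sub v' (length L) i
  rsv zero    = rv
  rsv (suc i) = ∼var _
  rbody : subst (sv-sub v (length L)) t ∼ subst (sv-sub v' (length L')) t'
  rbody = transport (λ k → subst (sv-sub v (length L)) t ∼ subst (sv-sub v' k) t') (Pointwise-length rL)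
                    (∼-subst (sv-sub-ValueSub vv (length L)) rsv rt)

∼-step : ∀ {s s' s₁} → s ∼ s' → s ⟶ s₁ → Matched s' s₁ ⊎ MeaninglessAtSurface s
∼-step (∼inst a b ρ ρ' nm vρ rρ e e') st = inj₂ (at hole a ρ nm vρ e)
∼-step (∼var n) (root ())
∼-step (∼lam r) (root ())
∼-step (∼app r₁ r₂) (root (dB L t u))   = ∼-dB L t u r₁ r₂
∼-step (∼es r₁ r₂)  (root (sv L t v vv)) = ∼-sv L t v vv r₁ r₂
∼-step (∼app r₁ r₂) (appl st) with ∼-step r₁ st
... | inj₁ (_ , st' , r) = inj₁ (_ , appl st' , ∼app r r₂)
... | inj₂ m             = inj₂ (MeaninglessAtSurface-plugV (appL hole _) m)
∼-step (∼app r₁ r₂) (appr st) with ∼-step r₂ st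
... | inj₁ (_ , st' , r) = inj₁ (_ , appr st' , ∼app r₁ r)
... | inj₂ m             = inj₂ (MeaninglessAtSurface-plugV (appR _ hole) m)
∼-step (∼es r₁ r₂) (esl st) with ∼-step r₁ st
... | inj₁ (_ , st' , r) = inj₁ (_ , esl st' , ∼es r r₂)
... | inj₂ m             = inj₂ (MeaninglessAtSurface-plugV (esL hole _) m)
∼-step (∼es r₁ r₂) (esr st) with ∼-step r₂ st
... | inj₁ (_ , st' , r) = inj₁ (_ , esr st' , ∼es r₁ r)
... | inj₂ m             = inj₂ (MeaninglessAtSurface-plugV (esR _ hole) m)

-- Where a meaningless instance in surface position goes in one step

data Overlap (V : VCtx) (q : Term) (L : LCtx) (x : Term) : Set where
  inBody    : ∀ L₁ L₂ → L ≡ L₁ ++ L₂ → V ≡ chainV L₁ → q ≡ plugL L₂ x → Overlap V q L x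
  inContent : ∀ (G : Term → VCtx) → (∀ y → plugL L y ≡ plugV (G y) q) → Overlap V q L x

plugV≡plugL⁻ : ∀ V q L {x} → Value x → plugV V q ≡ plugL L x → Overlap V q L x
plugV≡plugL⁻ hole       q L       vx e = inBody [] L refl refl e
plugV≡plugL⁻ (appL V c) q []      () refl
plugV≡plugL⁻ (appL V c) q (s ∷ L) vx ()
plugV≡plugL⁻ (appR c V) q []      () refl
plugV≡plugL⁻ (appR c V) q (s ∷ L) vx ()
plugV≡plugL⁻ (esL V c)  q []      () refl
plugV≡plugL⁻ (esL V c)  q (s ∷ L) vx e with plugV≡plugL⁻ V q L vx (es-injectiveˡ e)
... | inBody L₁ L₂ refl refl e₂ = inBody (s ∷ L₁) L₂ refl (cong (esL (chainV L₁)) (es-injectiveʳ e)) e₂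
... | inContent G h             = inContent (λ y → esL (G y) c) (λ y → cong₂ es (h y) (sym (es-injectiveʳ e)))
plugV≡plugL⁻ (esR c V)  q []      () refl
plugV≡plugL⁻ (esR c V)  q (s ∷ L) vx e =
  inContent (λ y → esR (plugL L y) V) (λ y → cong (es (plugL L y)) (sym (es-injectiveʳ e)))

data Residual (s₁ q : Term) : Set where
  contracted : ∀ V r → s₁ ≡ plugV V r → (WMeaningful r → WMeaningful q) → Residual s₁ q
  persists   : ∀ V θ → ValueSub θ → s₁ ≡ plugV V (subst θ q) → Residual s₁ q

persists-unchanged : ∀ {s₁ q} V → s₁ ≡ plugV V q → Residual s₁ q
persists-unchanged {q = q} V e = persists V var vvar (trans e (cong (plugV V) (sym (subst-var q))))

Residual-plugV : ∀ V {s₁ q} → Residual s₁ q → Residual (plugV V s₁) q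
Residual-plugV V (contracted V₁ r e f) =
  contracted (compV V V₁) r (trans (cong (plugV V) e) (sym (plugV-compV V V₁ r))) f
Residual-plugV V (persists V₁ θ vθ e) =
  persists (compV V V₁) θ vθ (trans (cong (plugV V) e) (sym (plugV-compV V V₁ _)))

rename-+-+ : ∀ m n c → rename (_+ n) (rename (_+ m) c) ≡ rename (_+ (m + n)) c
rename-+-+ m n c = trans (rename-rename (_+ n) (_+ m) c) (rename-cong (λ i → +-assoc i m n) c)

residual-dB : ∀ L t c V q → app (plugL L (lam t)) c ≡ plugV V q →
  Residual (plugL L (es t (rename (_+ length L) c))) q
residual-dB L t c hole _ refl = contracted hole _ refl (WMeaningful-expand (root (dB L t c)))
residual-dB L t c (appL V c') q e with plugV≡plugL⁻ V q L (vlam t) (sym (app-injectiveˡ e))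
... | inContent G h = persists-unchanged (G _) (h _)
... | inBody L₁ L₂ refl refl refl =
  contracted (chainV L₁) (plugL L₂ (es t (rename (_+ length L₂) c₁))) reduct
             (WMeaningful-app⁻ ∘ WMeaningful-expand (root (dB L₂ t c₁)))
  where
  c₁ = rename (_+ length L₁) c
  reduct : plugL (L₁ ++ L₂) (es t (rename (_+ length (L₁ ++ L₂)) c))
         ≡ plugV (chainV L₁) (plugL L₂ (es t (rename (_+ length L₂) c₁)))
  reduct = begin
    plugL (L₁ ++ L₂) (es t (rename (_+ length (L₁ ++ L₂)) c))    ≡⟨ plugL-++ L₁ L₂ _ ⟩
    plugL L₁ (plugL L₂ (es t (rename (_+ length (L₁ ++ L₂)) c))) ≡⟨ cong (λ k → plugL L₁ (plugL L₂ (es t (rename (_+ k) c))))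
                                                                         (length-++ L₁) ⟩
    plugL L₁ (plugL L₂ (es t (rename (_+ (length L₁ + length L₂)) c))) ≡⟨ cong (λ z → plugL L₁ (plugL L₂ (es t z)))
                                                                               (sym (rename-+-+ (length L₁) (length L₂) c)) ⟩
    plugL L₁ (plugL L₂ (es t (rename (_+ length L₂) c₁)))        ≡⟨ sym (plugV-chainV L₁ _) ⟩
    plugV (chainV L₁) (plugL L₂ (es t (rename (_+ length L₂) c₁))) ∎
    where open ≡-Reasoning
residual-dB L t _ (appR _ V) q refl =
  persists (compV (chainV L) (esR t (substV shift V))) (holeSubV shift V) (holeSubV-ValueSub V (vvar ∘ _))
    (trans (cong (λ z → plugL L (es t z)) (trans (rename≗subst-var _ (plugV V q)) (subst-plugV shift V q)))
           (plugL-plugV L (esR t (substV shift V)) _))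
  where
  shift = var ∘ (_+ length L)
residual-dB L t c (esL V c') q ()
residual-dB L t c (esR c' V) q ()

residual-sv : ∀ L t v → Value v → ∀ V q → es t (plugL L v) ≡ plugV V q →
  Residual (plugL L (subst (sv-sub v (length L)) t)) q
residual-sv L t v vv hole _ refl = contracted hole _ refl (WMeaningful-expand (root (sv L t v vv)))
residual-sv L _ v vv (esL V _) q refl =
  persists (compV (chainV L) (substV σ V)) (holeSubV σ V) (holeSubV-ValueSub V (sv-sub-ValueSub vv (length L)))
    (trans (cong (plugL L) (subst-plugV σ V q)) (plugL-plugV L (substV σ V) _))
  where
  σ = sv-sub v (length L)
residual-sv L t v vv (esR c V) q e with plugV≡plugL⁻ V q L vv (sym (es-injectiveʳ e))
... | inContent G h = persists-unchanged (G _) (h _)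
... | inBody L₁ L₂ refl refl refl =
  contracted (chainV L₁) (plugL L₂ (subst (sv-sub v (length (L₁ ++ L₂))) t))
             (trans (plugL-++ L₁ L₂ _) (sym (plugV-chainV L₁ _))) (WMeaningful-plugL-value L₂ _ vv)
residual-sv L t v vv (appL V c) q ()
residual-sv L t v vv (appR c V) q ()

residual : ∀ {s s₁} → s ⟶ s₁ → ∀ V q → s ≡ plugV V q → Residual s₁ q
residual (root (dB L t c))    V q e = residual-dB L t c V q e
residual (root (sv L t v vv)) V q e = residual-sv L t v vv V q e
residual st hole q refl = contracted hole _ refl (WMeaningful-expand st)
residual (appl st) (appL V c) q refl = Residual-plugV (appL hole c) (residual st V q refl)
residual (appr st) (appR c V) q refl = Residual-plugV (appR c hole) (residual st V q refl)
residual (esl st)  (esL V c)  q refl = Residual-plugV (esL hole c) (residual st V q refl)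
residual (esr st)  (esR c V)  q refl = Residual-plugV (esR c hole) (residual st V q refl)
residual (appl {s' = s'} st) (appR _ V) q refl = persists-unchanged (appR s' V) refl
residual (appr {u' = u'} st) (appL V _) q refl = persists-unchanged (appL V u') refl
residual (esl {s' = s'} st)  (esR _ V)  q refl = persists-unchanged (esR s' V) refl
residual (esr {u' = u'} st)  (esL V _)  q refl = persists-unchanged (esL V u') refl
residual (appl st) (esL V c) q ()
residual (appl st) (esR c V) q ()
residual (appr st) (esL V c) q ()
residual (appr st) (esR c V) q ()
residual (esl st)  (appL V c) q ()
residual (esl st)  (appR c V) q ()
residual (esr st)  (appL V c) q ()
residual (esr st)  (appR c V) q ()

mutual
  ∼-⟶*value : ∀ {s s' v} → s ∼ s' → s ⟶* v → Value v → Σ Term λ w → Value w × s' ⟶* w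
  ∼-⟶*value (∼var n)   ε _  = var n , vvar n , ε
  ∼-⟶*value (∼lam r)   ε _  = lam _ , vlam _ , ε
  ∼-⟶*value (∼app _ _) ε ()
  ∼-⟶*value (∼es _ _)  ε ()
  ∼-⟶*value (∼inst a b ρ ρ' nm vρ rρ refl e') ε vv = ⊥-elim (nm (WMeaningful-value (Value-unsubst a ρ vv)))
  ∼-⟶*value r (st ◅ red) vv with ∼-step r st
  ... | inj₂ m = ⊥-elim (MeaninglessAtSurface-diverges m st red vv)
  ... | inj₁ (_ , st' , r₁) with ∼-⟶*value r₁ red vv
  ...   | w , vw , red' = w , vw , (st' ◅ red')

  -- Substituting Ω only after the first step keeps the mutual recursion structural.
  MeaninglessAtSurface-diverges : ∀ {s s₁ v} → MeaninglessAtSurface s → s ⟶ s₁ → s₁ ⟶* v → ¬ Value v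
  MeaninglessAtSurface-diverges (at V a ρ nm vρ e) st red vv with residual st V (subst ρ a) e
  ... | contracted V₁ r e₁ f =
    ∼Ω-at-surface-diverges V₁ e₁ (∼-meaningless (nm ∘ WMeaningful-unsubst ρ vρ a ∘ f) vvar (sym (subst-var r)) Ω) red vv
  ... | persists V₁ θ vθ e₁ =
    ∼Ω-at-surface-diverges V₁ e₁ (∼-meaningless nm (Value-subst vθ ∘ vρ) (subst-subst θ ρ a) Ω) red vv

  ∼Ω-at-surface-diverges : ∀ {s₁ v} V {x} → s₁ ≡ plugV V x → x ∼ Ω → s₁ ⟶* v → ¬ Value v
  ∼Ω-at-surface-diverges V refl r red vv with ∼-⟶*value (∼-plugV V r) red vv
  ... | w , vw , red' = SurfaceΩ-¬⟶*value (SurfaceΩ-plugV V isΩ) red' vw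

meaningless-∼ : ∀ {t} → ¬ Meaningful t → ∀ u → t ∼ u
meaningless-∼ {t} ¬mt u =
  transport (t ∼_) (subst-var u) (∼-meaningless (¬mt ∘ WMeaningful⇒Meaningful) vvar (sym (subst-var t)) u)

theorem5p15 : (F : FCtx) (t : Term) → ¬ Meaningful t → Meaningful (plugF F t) →
    (u : Term) → Meaningful (plugF F u)
theorem5p15 F t ¬mt (T , v , vv , red) u
  with ∼-⟶*value (∼-plugT T (∼-plugF F (meaningless-∼ ¬mt u))) (→v*⇒⟶* red) vv
... | w , vw , red' = T , w , vw , ⟶*⇒→v* red'
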